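{- Let $d\in\mathbb{Z}$ and let $(a_n)_{n\geq1}$ be the unique sequence of integers such that, as formal power series, \[ 1-x-\sum_{n=1}^{\infty}d^{n}x^{n+1}=\prod_{n=1}^{\infty}(1-a_{n}x^{n}). \] Then for every prime $p$, \[ a_{p}=\frac{(d+1)^{p}-d^{p}-1}{p}. \] In particular, $\frac{(d+1)^{p}-d^{p}-1}{p}$ is an integer.
   Context: Every formal power series with integer coefficients and constant term $1$ can be written uniquely as a formal infinite product $\prod_{n\geq1}(1-c_nx^n)$ with $c_n\in\mathbb{Z}$; $(a_n)$ is the sequence so obtained for the series $1-x-\sum_{n\geq1}d^nx^{n+1}=\frac{1-(d+1)x}{1-dx}$. -}

module Defs where

open import Data.Nat using (ℕ; zero; suc; _∸_; _≟_)
open import Data.Integer using (ℤ; +_; -_; _+_; _*_; _^_)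
open import Relation.Nullary using (yes; no)
open import Relation.Binary.PropositionalEquality using (_≡_)

Series : Set
Series = ℕ → ℤ

sumTo : (ℕ → ℤ) → ℕ → ℤ
sumTo f zero    = f zero
sumTo f (suc m) = sumTo f m + f (suc m)

_⊛_ : Series → Series → Series
(f ⊛ g) m = sumTo (λ k → f k * g (m ∸ k)) m

oneS : Series
oneS zero    = + 1
oneS (suc _) = + 0

factor : (ℕ → ℤ) → ℕ → Series
factor c n zero = + 1
factor c n (suc m) with suc m ≟ n
... | yes _ = - c n
... | no  _ = + 0

prodUpTo : (ℕ → ℤ) → ℕ → Series
prodUpTo c zero    = oneS
prodUpTo c (suc N) = prodUpTo c N ⊛ factor c (suc N)

-- Coefficient of x^m in the infinite product ∏_{n≥1}(1 - c n x^n):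
-- only the factors with n ≤ m contribute, so it is the m-th coefficient
-- of the partial product up to m.
infProdCoeff : (ℕ → ℤ) → Series
infProdCoeff c m = prodUpTo c m m

target : ℤ → Series
target d zero          = + 1
target d (suc zero)    = - (+ 1)
target d (suc (suc n)) = - (d ^ suc n)

-- c is the product-exponent sequence of f (c 0 is irrelevant).
IsProductExpansion : (ℕ → ℤ) → Series → Set
IsProductExpansion c f = ∀ m → infProdCoeff c m ≡ f m

module Submission where

-- Proof idea: logarithmic derivatives.  For a series S let θS = x·S'
-- (coefficients m·S_m); A is a logarithmic derivative of S when θS = S·A.
-- These add under multiplication, and that of the factor 1 - a·x^n is
-- -Σ_{q≥1} n·a^q·x^{nq}.  Hence the partial product
-- ∏_{n≤p}(1 - a_n x^n) has logarithmic derivative whose x^p-coefficient is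
-- -Σ_{n ∣ p} n·a_n^{p/n}; for p prime this is -a_1^p - p·a_p.
-- On the other side the target series times (1 - d·x) equals 1 - (d+1)·x,
-- and both products agree with  ∏_{n≤p}(1 - a_n x^n)·(1 - d·x)  up to x^p.
-- Since a logarithmic derivative of a series with constant term 1 is
-- determined degree by degree, the x^p-coefficients agree:
--   -a_1^p - p·a_p - d^p = -(d+1)^p,   and a_1 = 1.

open import Defs
open import Data.Nat using (ℕ)
open import Data.Nat.Primality using (Prime)
open import Data.Integer using (ℤ; +_; _+_; _-_; _*_; _^_)

open import Data.Nat as ℕ using (zero; suc; _∸_; _≤_; _<_; z≤n; s≤s; _%_; _/_; NonZero)
import Data.Nat.Properties as ℕP
open import Data.Nat.DivMod using (m<n⇒m%n≡m; n%n≡0; n/n≡1; [m+n]%n≡m%n; m/n≡1+[m∸n]/n; n%1≡0; n/1≡n)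
open import Data.Nat.Divisibility using (_∣_; divides; m%n≡0⇒n∣m)
open import Data.Nat.Divisibility.Core using (hasNonTrivialDivisor)
open import Data.Nat.Primality using (prime⇒rough; prime⇒nonTrivial; prime⇒nonZero)
open import Data.Integer using (-_; 0ℤ; 1ℤ)
import Data.Integer.Properties as ℤP
open import Data.Integer.Tactic.RingSolver using (solve-∀)
open import Algebra.Bundles using (AbelianGroup)
open import Algebra.Properties.Group (AbelianGroup.group ℤP.+-0-abelianGroup) using (∙-cancelʳ)
open import Data.Empty using (⊥-elim)
open import Data.Sum using (inj₁; inj₂)
open import Data.Product using (_,_)
open import Relation.Nullary using (¬_; yes; no; contradiction)
open import Relation.Binary.PropositionalEquality
open ≡-Reasoning

sumTo-cong : ∀ {f g : ℕ → ℤ} m → (∀ k → k ≤ m → f k ≡ g k) → sumTo f m ≡ sumTo g m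
sumTo-cong zero    f≗g = f≗g 0 z≤n
sumTo-cong (suc m) f≗g =
  cong₂ _+_ (sumTo-cong m (λ k k≤m → f≗g k (ℕP.m≤n⇒m≤1+n k≤m))) (f≗g (suc m) ℕP.≤-refl)

sumTo-+ : ∀ (f g : ℕ → ℤ) m → sumTo (λ k → f k + g k) m ≡ sumTo f m + sumTo g m
sumTo-+ f g zero    = refl
sumTo-+ f g (suc m) =
  trans (cong (_+ (f (suc m) + g (suc m))) (sumTo-+ f g m))
        (interchange (sumTo f m) (sumTo g m) (f (suc m)) (g (suc m)))
  where
  interchange : ∀ a b c d → (a + b) + (c + d) ≡ (a + c) + (b + d)
  interchange = solve-∀

sumTo-scale : ∀ (c : ℤ) (f : ℕ → ℤ) m → sumTo (λ k → c * f k) m ≡ c * sumTo f m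
sumTo-scale c f zero    = refl
sumTo-scale c f (suc m) =
  trans (cong (_+ c * f (suc m)) (sumTo-scale c f m)) (sym (ℤP.*-distribˡ-+ c (sumTo f m) (f (suc m))))

sumTo-zero : ∀ (f : ℕ → ℤ) m → (∀ k → k ≤ m → f k ≡ 0ℤ) → sumTo f m ≡ 0ℤ
sumTo-zero f m f≗0 = trans (sumTo-cong m f≗0) (sum-of-zeros m)
  where
  sum-of-zeros : ∀ m → sumTo (λ _ → 0ℤ) m ≡ 0ℤ
  sum-of-zeros zero    = refl
  sum-of-zeros (suc m) = cong (_+ 0ℤ) (sum-of-zeros m)

sumTo-peel : ∀ (f : ℕ → ℤ) m → sumTo f (suc m) ≡ f 0 + sumTo (λ k → f (suc k)) m
sumTo-peel f zero    = refl
sumTo-peel f (suc m) = trans (cong (_+ f (suc (suc m))) (sumTo-peel f m)) (ℤP.+-assoc (f 0) _ _)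

infixl 6 _⊕_
infixr 7 _·_

_⊕_ : Series → Series → Series
(f ⊕ g) m = f m + g m

_·_ : ℤ → Series → Series
(c · f) m = c * f m

zeroS : Series
zeroS _ = 0ℤ

shift : ℕ → Series → Series
shift zero    S m       = S m
shift (suc n) S zero    = 0ℤ
shift (suc n) S (suc m) = shift n S m

shift-cong : ∀ n {S S' : Series} m → (∀ k → S k ≡ S' k) → shift n S m ≡ shift n S' m
shift-cong zero    m       S≗S' = S≗S' m
shift-cong (suc n) zero    S≗S' = refl
shift-cong (suc n) (suc m) S≗S' = shift-cong n m S≗S'

shift-below : ∀ n S m → m < n → shift n S m ≡ 0ℤ
shift-below (suc n) S zero    _         = refl
shift-below (suc n) S (suc m) (s≤s m<n) = shift-below n S m m<n

shift-above : ∀ n S r → shift n S (n ℕ.+ r) ≡ S r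
shift-above zero    S r = refl
shift-above (suc n) S r = shift-above n S r

shift-origin : ∀ n S → shift n S n ≡ S 0
shift-origin zero    S = refl
shift-origin (suc n) S = shift-origin n S

shift-oneS-off : ∀ n m → m ≢ n → shift n oneS m ≡ 0ℤ
shift-oneS-off zero    zero    m≢n = contradiction refl m≢n
shift-oneS-off zero    (suc m) m≢n = refl
shift-oneS-off (suc n) zero    m≢n = refl
shift-oneS-off (suc n) (suc m) m≢n = shift-oneS-off n m (λ m≡n → m≢n (cong suc m≡n))

shift-weight : ∀ n S m → + m * shift n S m ≡ shift n (λ k → + k * S k) m + + n * shift n S m
shift-weight zero    S m       = sym (trans (cong (_+_ (+ m * S m)) (ℤP.*-zeroˡ (S m))) (ℤP.+-identityʳ _))
shift-weight (suc n) S zero    = sym (trans (ℤP.+-identityˡ _) (ℤP.*-zeroʳ (+ suc n)))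
shift-weight (suc n) S (suc m) = begin
  + suc m * Y           ≡⟨ peel (+ m) Y ⟩
  + m * Y + Y           ≡⟨ cong (_+ Y) (shift-weight n S m) ⟩
  (X + + n * Y) + Y     ≡⟨ regroup X (+ n) Y ⟩
  X + + suc n * Y       ∎
  where
  X : ℤ
  X = shift n (λ k → + k * S k) m
  Y : ℤ
  Y = shift n S m
  peel : ∀ m y → (+ 1 + m) * y ≡ m * y + y
  peel = solve-∀
  regroup : ∀ x n y → (x + n * y) + y ≡ x + (+ 1 + n) * y
  regroup = solve-∀

conv-agreeˡ : ∀ {S S' : Series} T m → (∀ k → k ≤ m → S k ≡ S' k) → (S ⊛ T) m ≡ (S' ⊛ T) m
conv-agreeˡ T m S≗S' = sumTo-cong m (λ k k≤m → cong (_* T (m ∸ k)) (S≗S' k k≤m))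

conv-congʳ : ∀ S {T T' : Series} m → (∀ k → T k ≡ T' k) → (S ⊛ T) m ≡ (S ⊛ T') m
conv-congʳ S m T≗T' = sumTo-cong m (λ k _ → cong (S k *_) (T≗T' (m ∸ k)))

conv-+ˡ : ∀ S S' T m → ((S ⊕ S') ⊛ T) m ≡ (S ⊛ T) m + (S' ⊛ T) m
conv-+ˡ S S' T m =
  trans (sumTo-cong m (λ k _ → ℤP.*-distribʳ-+ (T (m ∸ k)) (S k) (S' k))) (sumTo-+ _ _ m)

conv-+ʳ : ∀ S T T' m → (S ⊛ (T ⊕ T')) m ≡ (S ⊛ T) m + (S ⊛ T') m
conv-+ʳ S T T' m =
  trans (sumTo-cong m (λ k _ → ℤP.*-distribˡ-+ (S k) (T (m ∸ k)) (T' (m ∸ k)))) (sumTo-+ _ _ m)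

conv-·ˡ : ∀ c S T m → ((c · S) ⊛ T) m ≡ c * (S ⊛ T) m
conv-·ˡ c S T m = trans (sumTo-cong m (λ k _ → ℤP.*-assoc c (S k) (T (m ∸ k)))) (sumTo-scale c _ m)

conv-·ʳ : ∀ c S T m → (S ⊛ (c · T)) m ≡ c * (S ⊛ T) m
conv-·ʳ c S T m = trans (sumTo-cong m (λ k _ → swap (S k) (T (m ∸ k)))) (sumTo-scale c _ m)
  where
  swap : ∀ x y → x * (c * y) ≡ c * (x * y)
  swap x y = trans (sym (ℤP.*-assoc x c y)) (trans (cong (_* y) (ℤP.*-comm x c)) (ℤP.*-assoc c x y))

conv-oneʳ : ∀ S m → (S ⊛ oneS) m ≡ S m
conv-oneʳ S zero    = ℤP.*-identityʳ (S 0)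
conv-oneʳ S (suc m) = begin
  sumTo (λ k → S k * oneS (suc m ∸ k)) m + S (suc m) * oneS (m ∸ m)
    ≡⟨ cong₂ _+_ (sumTo-zero _ m earlier-terms) (cong (λ j → S (suc m) * oneS j) (ℕP.n∸n≡0 m)) ⟩
  0ℤ + S (suc m) * 1ℤ
    ≡⟨ trans (ℤP.+-identityˡ _) (ℤP.*-identityʳ _) ⟩
  S (suc m) ∎
  where
  earlier-terms : ∀ k → k ≤ m → S k * oneS (suc m ∸ k) ≡ 0ℤ
  earlier-terms k k≤m rewrite ℕP.+-∸-assoc 1 k≤m = ℤP.*-zeroʳ (S k)

conv-shiftʳ : ∀ n S T m → (S ⊛ shift n T) m ≡ shift n (S ⊛ T) m
conv-shiftʳ zero    S T m       = refl
conv-shiftʳ (suc n) S T zero    = ℤP.*-zeroʳ (S 0)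
conv-shiftʳ (suc n) S T (suc m) = begin
  sumTo (λ k → S k * shift (suc n) T (suc m ∸ k)) m + S (suc m) * shift (suc n) T (m ∸ m)
    ≡⟨ cong₂ _+_ (sumTo-cong m earlier-terms) last-term ⟩
  (S ⊛ shift n T) m + 0ℤ
    ≡⟨ trans (ℤP.+-identityʳ _) (conv-shiftʳ n S T m) ⟩
  shift n (S ⊛ T) m ∎
  where
  earlier-terms : ∀ k → k ≤ m → S k * shift (suc n) T (suc m ∸ k) ≡ S k * shift n T (m ∸ k)
  earlier-terms k k≤m rewrite ℕP.+-∸-assoc 1 k≤m = refl
  last-term : S (suc m) * shift (suc n) T (m ∸ m) ≡ 0ℤ
  last-term rewrite ℕP.n∸n≡0 m = ℤP.*-zeroʳ (S (suc m))

conv-shiftˡ : ∀ n S T m → (shift n S ⊛ T) m ≡ shift n (S ⊛ T) m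
conv-shiftˡ zero    S T m       = refl
conv-shiftˡ (suc n) S T zero    = ℤP.*-zeroˡ (T 0)
conv-shiftˡ (suc n) S T (suc m) = begin
  (shift (suc n) S ⊛ T) (suc m)  ≡⟨ sumTo-peel (λ k → shift (suc n) S k * T (suc m ∸ k)) m ⟩
  0ℤ * T (suc m) + (shift n S ⊛ T) m  ≡⟨ ℤP.+-identityˡ _ ⟩
  (shift n S ⊛ T) m  ≡⟨ conv-shiftˡ n S T m ⟩
  shift n (S ⊛ T) m  ∎

-- Multiplying by a factor 1 - c·x^n  (n = suc i)

factor-decomp : ∀ c i m → factor c (suc i) m ≡ oneS m + (- c (suc i)) * shift (suc i) oneS m
factor-decomp c i zero = sym (trans (cong (_+_ 1ℤ) (ℤP.*-zeroʳ (- c (suc i)))) (ℤP.+-identityʳ 1ℤ))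
factor-decomp c i (suc m) with suc m ℕ.≟ suc i
... | yes refl = sym (trans (cong (λ t → 0ℤ + (- c (suc i)) * t) (shift-origin i oneS))
                            (trans (ℤP.+-identityˡ _) (ℤP.*-identityʳ _)))
... | no m≢n   = sym (trans (cong (λ t → 0ℤ + (- c (suc i)) * t) (shift-oneS-off (suc i) (suc m) m≢n))
                            (trans (ℤP.+-identityˡ _) (ℤP.*-zeroʳ (- c (suc i)))))

conv-factor : ∀ S c i m → (S ⊛ factor c (suc i)) m ≡ S m + (- c (suc i)) * shift (suc i) S m
conv-factor S c i m = begin
  (S ⊛ factor c (suc i)) m                 ≡⟨ conv-congʳ S m (factor-decomp c i) ⟩
  (S ⊛ (oneS ⊕ b · shift (suc i) oneS)) m  ≡⟨ conv-+ʳ S oneS (b · shift (suc i) oneS) m ⟩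
  (S ⊛ oneS) m + (S ⊛ (b · shift (suc i) oneS)) m
    ≡⟨ cong₂ _+_ (conv-oneʳ S m) (conv-·ʳ b S (shift (suc i) oneS) m) ⟩
  S m + b * (S ⊛ shift (suc i) oneS) m
    ≡⟨ cong (λ t → S m + b * t) (trans (conv-shiftʳ (suc i) S oneS m) (shift-cong (suc i) m (conv-oneʳ S))) ⟩
  S m + b * shift (suc i) S m              ∎
  where
  b : ℤ
  b = - c (suc i)

-- The instance of associativity  (S·F)·T = S·T - c·x^n(S·T)  that is needed.
conv-factor-assoc : ∀ S c i T m →
  ((S ⊛ factor c (suc i)) ⊛ T) m ≡ (S ⊛ T) m + (- c (suc i)) * (shift (suc i) S ⊛ T) m
conv-factor-assoc S c i T m = begin
  ((S ⊛ factor c (suc i)) ⊛ T) m  ≡⟨ conv-agreeˡ T m (λ k _ → conv-factor S c i k) ⟩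
  ((S ⊕ b · shift (suc i) S) ⊛ T) m  ≡⟨ conv-+ˡ S _ T m ⟩
  (S ⊛ T) m + ((b · shift (suc i) S) ⊛ T) m  ≡⟨ cong (_+_ ((S ⊛ T) m)) (conv-·ˡ b _ T m) ⟩
  (S ⊛ T) m + b * (shift (suc i) S ⊛ T) m  ∎
  where
  b : ℤ
  b = - c (suc i)

prodUpTo-stable : ∀ c N m → m ≤ N → prodUpTo c N m ≡ prodUpTo c m m
prodUpTo-stable c zero    zero z≤n = refl
prodUpTo-stable c (suc N) m m≤N+1 with ℕP.m≤n⇒m<n∨m≡n m≤N+1
... | inj₂ refl       = refl
... | inj₁ (s≤s m≤N) = begin
  prodUpTo c (suc N) m  ≡⟨ conv-factor (prodUpTo c N) c N m ⟩
  prodUpTo c N m + (- c (suc N)) * shift (suc N) (prodUpTo c N) m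
    ≡⟨ cong (λ t → prodUpTo c N m + (- c (suc N)) * t) (shift-below (suc N) _ m (s≤s m≤N)) ⟩
  prodUpTo c N m + (- c (suc N)) * 0ℤ
    ≡⟨ trans (cong (_+_ (prodUpTo c N m)) (ℤP.*-zeroʳ (- c (suc N)))) (ℤP.+-identityʳ _) ⟩
  prodUpTo c N m  ≡⟨ prodUpTo-stable c N m m≤N ⟩
  prodUpTo c m m  ∎

-- Logarithmic derivatives

-- A is a logarithmic derivative of S:  x·S' = S·A.
LogDeriv : Series → Series → Set
LogDeriv S A = ∀ m → + m * S m ≡ (S ⊛ A) m

logDeriv-oneS : LogDeriv oneS zeroS
logDeriv-oneS m = trans (weight-oneS m) (sym (sumTo-zero _ m (λ k _ → ℤP.*-zeroʳ (oneS k))))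
  where
  weight-oneS : ∀ m → + m * oneS m ≡ 0ℤ
  weight-oneS zero    = refl
  weight-oneS (suc m) = ℤP.*-zeroʳ (+ suc m)

onMultiples : ℕ → ℤ → ℤ
onMultiples zero    v = v
onMultiples (suc _) v = 0ℤ

-- The logarithmic derivative of 1 - a·x^n  (n = suc i):
--   -n·a·x^n/(1 - a·x^n) = -Σ_{q≥1} n·a^q·x^{nq}.
logFactor : ℤ → ℕ → Series
logFactor a i zero    = 0ℤ
logFactor a i (suc m) = onMultiples (suc m % suc i) (- (+ suc i * a ^ (suc m / suc i)))

logFactor-below : ∀ a i m → m < suc i → logFactor a i m ≡ 0ℤ
logFactor-below a i zero    _   = refl
logFactor-below a i (suc m) m<n = cong (λ r → onMultiples r (- (+ suc i * a ^ (suc m / suc i)))) (m<n⇒m%n≡m m<n)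

logFactor-shifted : ∀ a i k →
  logFactor a i (suc i ℕ.+ k) ≡ onMultiples (k % suc i) (- (+ suc i * a ^ suc (k / suc i)))
logFactor-shifted a i k = cong₂ (λ r q → onMultiples r (- (+ n * a ^ q))) remainder quotient
  where
  n : ℕ
  n = suc i
  remainder : (n ℕ.+ k) % n ≡ k % n
  remainder = trans (cong (_% n) (ℕP.+-comm n k)) ([m+n]%n≡m%n k n)
  quotient : (n ℕ.+ k) / n ≡ suc (k / n)
  quotient = trans (m/n≡1+[m∸n]/n (ℕP.m≤m+n n k)) (cong (λ x → suc (x / n)) (ℕP.m+n∸m≡n n k))

-- Along the multiples of n the coefficients of logFactor form a geometric
-- progression with ratio a.
onMultiples-geometric : ∀ a n R Q →
  onMultiples R (- (n * a ^ suc Q)) + (- a) * onMultiples R (- (n * a ^ Q)) ≡ ((- a) * n) * 0ℤ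
onMultiples-geometric a n zero    Q = geometric n a (a ^ Q)
  where
  geometric : ∀ n a b → - (n * (a * b)) + (- a) * (- (n * b)) ≡ ((- a) * n) * + 0
  geometric = solve-∀
onMultiples-geometric a n (suc _) Q =
  trans (ℤP.+-identityˡ _) (trans (ℤP.*-zeroʳ (- a)) (sym (ℤP.*-zeroʳ ((- a) * n))))

-- The defining relation  g·(1 - a x^n) = -n·a·x^n  of g = logFactor a i.
logFactor-law : ∀ a i m →
  logFactor a i m + (- a) * shift (suc i) (logFactor a i) m ≡ ((- a) * + suc i) * shift (suc i) oneS m
logFactor-law a i m with m ℕ.<? suc i
... | yes m<n rewrite logFactor-below a i m m<n | shift-below (suc i) (logFactor a i) m m<n
                    | shift-below (suc i) oneS m m<n | ℤP.*-zeroʳ (- a) = sym (ℤP.*-zeroʳ ((- a) * + suc i))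
... | no m≮n with ℕP.m≤n⇒∃[o]m+o≡n (ℕP.≮⇒≥ m≮n)
...   | k , refl rewrite logFactor-shifted a i k | shift-above (suc i) (logFactor a i) k
                       | shift-above (suc i) oneS k = at-multiple k
  where
  n : ℤ
  n = + suc i
  at-multiple : ∀ k → onMultiples (k % suc i) (- (n * a ^ suc (k / suc i))) + (- a) * logFactor a i k
                      ≡ ((- a) * n) * oneS k
  at-multiple zero    = first a n
    where
    first : ∀ a n → - (n * (a * + 1)) + (- a) * + 0 ≡ ((- a) * n) * + 1
    first = solve-∀
  at-multiple (suc r) = onMultiples-geometric a n (suc r % suc i) (suc r / suc i)

conv-logFactor-law : ∀ S a i m →
  (S ⊛ logFactor a i) m + (- a) * (shift (suc i) S ⊛ logFactor a i) m
    ≡ ((- a) * + suc i) * shift (suc i) S m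
conv-logFactor-law S a i m = begin
  (S ⊛ g) m + b * (σS ⊛ g) m
    ≡⟨ cong (λ t → (S ⊛ g) m + b * t) shift-sides ⟩
  (S ⊛ g) m + b * (S ⊛ shift n g) m
    ≡⟨ cong (_+_ ((S ⊛ g) m)) (sym (conv-·ʳ b S (shift n g) m)) ⟩
  (S ⊛ g) m + (S ⊛ (b · shift n g)) m
    ≡⟨ sym (conv-+ʳ S g (b · shift n g) m) ⟩
  (S ⊛ (g ⊕ b · shift n g)) m
    ≡⟨ conv-congʳ S m (logFactor-law a i) ⟩
  (S ⊛ ((b * + n) · shift n oneS)) m
    ≡⟨ conv-·ʳ (b * + n) S (shift n oneS) m ⟩
  (b * + n) * (S ⊛ shift n oneS) m
    ≡⟨ cong ((b * + n) *_) (trans (conv-shiftʳ n S oneS m) (shift-cong n m (conv-oneʳ S))) ⟩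
  (b * + n) * σS m ∎
  where
  n : ℕ
  n = suc i
  b : ℤ
  b = - a
  g : Series
  g = logFactor a i
  σS : Series
  σS = shift n S
  shift-sides : (σS ⊛ g) m ≡ (S ⊛ shift n g) m
  shift-sides = trans (conv-shiftˡ n S g m) (sym (conv-shiftʳ n S g m))

logDeriv-mulFactor : ∀ S A c i → LogDeriv S A →
  LogDeriv (S ⊛ factor c (suc i)) (A ⊕ logFactor (c (suc i)) i)
logDeriv-mulFactor S A c i θS≡SA m = begin
  + m * (S ⊛ F) m                                     ≡⟨ cong (+ m *_) (conv-factor S c i m) ⟩
  + m * (S m + b * σS m)                              ≡⟨ distribute (+ m) (S m) b (σS m) ⟩
  + m * S m + b * (+ m * σS m)                        ≡⟨ cong₂ (λ x y → x + b * y) (θS≡SA m) θσS ⟩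
  (S ⊛ A) m + b * ((σS ⊛ A) m + + n * σS m)
    ≡⟨ collect ((S ⊛ A) m) ((σS ⊛ A) m) ((S ⊛ g) m) ((σS ⊛ g) m) (σS m) (conv-logFactor-law S a i m) ⟩
  ((S ⊛ A) m + (S ⊛ g) m) + b * ((σS ⊛ A) m + (σS ⊛ g) m)
    ≡⟨ sym (cong₂ (λ x y → x + b * y) (conv-+ʳ S A g m) (conv-+ʳ σS A g m)) ⟩
  (S ⊛ (A ⊕ g)) m + b * (σS ⊛ (A ⊕ g)) m              ≡⟨ sym (conv-factor-assoc S c i (A ⊕ g) m) ⟩
  ((S ⊛ F) ⊛ (A ⊕ g)) m                               ∎
  where
  n : ℕ
  n = suc i
  a : ℤ
  a = c n
  b : ℤ
  b = - a
  F : Series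
  F = factor c n
  g : Series
  g = logFactor a i
  σS : Series
  σS = shift n S
  θσS : + m * σS m ≡ (σS ⊛ A) m + + n * σS m
  θσS = trans (shift-weight n S m)
              (cong (_+ + n * σS m) (trans (shift-cong n m θS≡SA) (sym (conv-shiftˡ n S A m))))
  distribute : ∀ m s b t → m * (s + b * t) ≡ m * s + b * (m * t)
  distribute = solve-∀
  collect : ∀ X Y G H T → G + b * H ≡ (b * + n) * T →
            X + b * (Y + + n * T) ≡ (X + G) + b * (Y + H)
  collect X Y G H T law = begin
    X + b * (Y + + n * T)          ≡⟨ expand X Y b (+ n) T ⟩
    (X + b * Y) + (b * + n) * T    ≡⟨ cong (_+_ (X + b * Y)) (sym law) ⟩
    (X + b * Y) + (G + b * H)      ≡⟨ regroup X Y G H b ⟩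
    (X + G) + b * (Y + H)          ∎
    where
    expand : ∀ X Y b n T → X + b * (Y + n * T) ≡ (X + b * Y) + (b * n) * T
    expand = solve-∀
    regroup : ∀ X Y G H b → (X + b * Y) + (G + b * H) ≡ (X + G) + b * (Y + H)
    regroup = solve-∀

logProd : (ℕ → ℤ) → ℕ → Series
logProd c zero    = zeroS
logProd c (suc N) = logProd c N ⊕ logFactor (c (suc N)) N

logDeriv-prodUpTo : ∀ c N → LogDeriv (prodUpTo c N) (logProd c N)
logDeriv-prodUpTo c zero    = logDeriv-oneS
logDeriv-prodUpTo c (suc N) = logDeriv-mulFactor (prodUpTo c N) (logProd c N) c N (logDeriv-prodUpTo c N)

logDeriv-constant : ∀ W A → W 0 ≡ 1ℤ → LogDeriv W A → A 0 ≡ 0ℤ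
logDeriv-constant W A W₀≡1 θW≡WA = begin
  A 0       ≡⟨ sym (ℤP.*-identityˡ (A 0)) ⟩
  1ℤ * A 0  ≡⟨ cong (_* A 0) (sym W₀≡1) ⟩
  W 0 * A 0 ≡⟨ sym (θW≡WA 0) ⟩
  0ℤ * W 0  ≡⟨ ℤP.*-zeroˡ (W 0) ⟩
  0ℤ        ∎

logDeriv-recurrence : ∀ W A → W 0 ≡ 1ℤ → LogDeriv W A → ∀ m →
  + suc m * W (suc m) ≡ A (suc m) + sumTo (λ j → W (suc j) * A (m ∸ j)) m
logDeriv-recurrence W A W₀≡1 θW≡WA m = begin
  + suc m * W (suc m)  ≡⟨ θW≡WA (suc m) ⟩
  (W ⊛ A) (suc m)      ≡⟨ sumTo-peel (λ k → W k * A (suc m ∸ k)) m ⟩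
  W 0 * A (suc m) + sumTo (λ j → W (suc j) * A (m ∸ j)) m
    ≡⟨ cong (λ w → w * A (suc m) + sumTo (λ j → W (suc j) * A (m ∸ j)) m) W₀≡1 ⟩
  1ℤ * A (suc m) + sumTo (λ j → W (suc j) * A (m ∸ j)) m
    ≡⟨ cong (_+ sumTo (λ j → W (suc j) * A (m ∸ j)) m) (ℤP.*-identityˡ (A (suc m))) ⟩
  A (suc m) + sumTo (λ j → W (suc j) * A (m ∸ j)) m  ∎

logDeriv-unique : ∀ W U A B p → W 0 ≡ 1ℤ → (∀ k → k ≤ p → W k ≡ U k) →
  LogDeriv W A → LogDeriv U B → ∀ m → m ≤ p → A m ≡ B m
logDeriv-unique W U A B p W₀≡1 W≗U θW≡WA θU≡UB m m≤p = agree-upto m m≤p m ℕP.≤-refl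
  where
  U₀≡1 : U 0 ≡ 1ℤ
  U₀≡1 = trans (sym (W≗U 0 z≤n)) W₀≡1
  agree-upto : ∀ m → m ≤ p → ∀ k → k ≤ m → A k ≡ B k
  agree-upto zero _ zero z≤n =
    trans (logDeriv-constant W A W₀≡1 θW≡WA) (sym (logDeriv-constant U B U₀≡1 θU≡UB))
  agree-upto (suc m) m+1≤p k k≤m+1 with ℕP.m≤n⇒m<n∨m≡n k≤m+1
  ... | inj₁ (s≤s k≤m) = agree-upto m (ℕP.<⇒≤ m+1≤p) k k≤m
  ... | inj₂ refl      = ∙-cancelʳ (sumTo (λ j → U (suc j) * B (m ∸ j)) m) (A (suc m)) (B (suc m)) (begin
    A (suc m) + sumTo (λ j → U (suc j) * B (m ∸ j)) m  ≡⟨ cong (_+_ (A (suc m))) (sym sums-agree) ⟩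
    A (suc m) + sumTo (λ j → W (suc j) * A (m ∸ j)) m  ≡⟨ sym (logDeriv-recurrence W A W₀≡1 θW≡WA m) ⟩
    + suc m * W (suc m)                                 ≡⟨ cong (+ suc m *_) (W≗U (suc m) m+1≤p) ⟩
    + suc m * U (suc m)                                 ≡⟨ logDeriv-recurrence U B U₀≡1 θU≡UB m ⟩
    B (suc m) + sumTo (λ j → U (suc j) * B (m ∸ j)) m  ∎)
    where
    sums-agree : sumTo (λ j → W (suc j) * A (m ∸ j)) m ≡ sumTo (λ j → U (suc j) * B (m ∸ j)) m
    sums-agree = sumTo-cong m (λ j j≤m →
      cong₂ _*_ (W≗U (suc j) (ℕP.≤-trans (s≤s j≤m) m+1≤p))
                (agree-upto m (ℕP.<⇒≤ m+1≤p) (m ∸ j) (ℕP.m∸n≤m m j)))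

-- The x^p-coefficient of the logarithmic derivative, p prime

logFactor-off : ∀ a i m → ¬ (suc i ∣ m) → logFactor a i m ≡ 0ℤ
logFactor-off a i zero    n∤m = contradiction (divides 0 refl) n∤m
logFactor-off a i (suc m) n∤m with suc m % suc i in eq
... | zero  = contradiction (m%n≡0⇒n∣m (suc m) (suc i) eq) n∤m
... | suc _ = refl

logFactor-top : ∀ a i → logFactor a i (suc i) ≡ - (+ suc i * a)
logFactor-top a i =
  trans (cong₂ (λ r q → onMultiples r (- (+ suc i * a ^ q))) (n%n≡0 (suc i)) (n/n≡1 (suc i)))
        (cong (λ t → - (+ suc i * t)) (ℤP.^-identityʳ a))

logFactor-linear : ∀ a m → .{{NonZero m}} → logFactor a 0 m ≡ - (a ^ m)
logFactor-linear a (suc m) =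
  trans (cong₂ (λ r q → onMultiples r (- (1ℤ * a ^ q))) (n%1≡0 (suc m)) (n/1≡n (suc m)))
        (cong -_ (ℤP.*-identityˡ (a ^ suc m)))

-- Only the divisors 1 and p of a prime p contribute:  -a₁^p - p·a_p.
logProd-at-prime : ∀ a p → Prime p → logProd a p p ≡ - (a 1 ^ p) - + p * a p
logProd-at-prime a zero          p-prime = ⊥-elim (ℕ.NonTrivial.nonTrivial (prime⇒nonTrivial p-prime))
logProd-at-prime a (suc zero)    p-prime = ⊥-elim (ℕ.NonTrivial.nonTrivial (prime⇒nonTrivial p-prime))
logProd-at-prime a (suc (suc q)) p-prime =
  cong₂ _+_ (below-p q ℕP.≤-refl) (logFactor-top (a p) (suc q))
  where
  p : ℕ
  p = suc (suc q)
  below-p : ∀ j → suc j < p → logProd a (suc j) p ≡ - (a 1 ^ p)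
  below-p zero    _    = trans (ℤP.+-identityˡ _) (logFactor-linear (a 1) p)
  below-p (suc j) j+2<p = begin
    logProd a (suc j) p + logFactor (a (suc (suc j))) (suc j) p
      ≡⟨ cong₂ _+_ (below-p j (ℕP.<-trans (ℕP.n<1+n (suc j)) j+2<p))
                   (logFactor-off (a (suc (suc j))) (suc j) p j+2∤p) ⟩
    - (a 1 ^ p) + 0ℤ  ≡⟨ ℤP.+-identityʳ _ ⟩
    - (a 1 ^ p)       ∎
    where
    j+2∤p : ¬ (suc (suc j) ∣ p)
    j+2∤p j+2∣p = prime⇒rough p-prime (hasNonTrivialDivisor j+2<p j+2∣p)

target-times-factor : ∀ d m →
  (target d ⊛ factor (λ _ → d) 1) m ≡ (oneS ⊛ factor (λ _ → d + 1ℤ) 1) m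
target-times-factor d m =
  trans (conv-factor (target d) (λ _ → d) 0 m)
        (trans (coefficients m) (sym (conv-factor oneS (λ _ → d + 1ℤ) 0 m)))
  where
  coefficients : ∀ m → target d m + (- d) * shift 1 (target d) m ≡ oneS m + (- (d + 1ℤ)) * shift 1 oneS m
  coefficients zero                = constant d
    where
    constant : ∀ d → + 1 + (- d) * + 0 ≡ + 1 + (- (d + + 1)) * + 0
    constant = solve-∀
  coefficients (suc zero)          = linear d
    where
    linear : ∀ d → - (+ 1) + (- d) * (+ 1) ≡ + 0 + (- (d + + 1)) * (+ 1)
    linear = solve-∀
  coefficients (suc (suc zero))    = quadratic d
    where
    quadratic : ∀ d → - (d * + 1) + (- d) * (- (+ 1)) ≡ + 0 + (- (d + + 1)) * (+ 0)
    quadratic = solve-∀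
  coefficients (suc (suc (suc j))) = higher d (d ^ suc j)
    where
    higher : ∀ d e → - (d * e) + (- d) * (- e) ≡ + 0 + (- (d + + 1)) * (+ 0)
    higher = solve-∀

-- The first exponent is forced by the coefficient of x.
expansion-first : ∀ d a → IsProductExpansion a (target d) → a 1 ≡ 1ℤ
expansion-first d a expansion = begin
  a 1                              ≡⟨ negate-twice (a 1) ⟩
  - (+ 0 + (- a 1) * + 1)          ≡⟨ cong -_ (sym (conv-factor oneS a 0 1)) ⟩
  - prodUpTo a 1 1                 ≡⟨ cong -_ (expansion 1) ⟩
  1ℤ                               ∎
  where
  negate-twice : ∀ x → x ≡ - (+ 0 + (- x) * + 1)
  negate-twice = solve-∀

expansion-times-factor : ∀ d a p → IsProductExpansion a (target d) → ∀ k → k ≤ p →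
  (prodUpTo a p ⊛ factor (λ _ → d) 1) k ≡ (oneS ⊛ factor (λ _ → d + 1ℤ) 1) k
expansion-times-factor d a p expansion k k≤p =
  trans (conv-agreeˡ (factor (λ _ → d) 1) k
          (λ j j≤k → trans (prodUpTo-stable a p j (ℕP.≤-trans j≤k k≤p)) (expansion j)))
        (target-times-factor d k)

isolate : ∀ x D E → - 1ℤ - x + - D ≡ - E → x ≡ E - D - 1ℤ
isolate x D E eq = begin
  x                               ≡⟨ rearrange x D ⟩
  - (- 1ℤ - x + - D) - D - 1ℤ     ≡⟨ cong (λ t → - t - D - 1ℤ) eq ⟩
  - (- E) - D - 1ℤ                ≡⟨ cong (λ t → t - D - 1ℤ) (ℤP.neg-involutive E) ⟩
  E - D - 1ℤ                      ∎
  where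
  rearrange : ∀ x D → x ≡ - (- + 1 - x + - D) - D - + 1
  rearrange = solve-∀

mainTheorem3 : (d : ℤ) (a : ℕ → ℤ) → IsProductExpansion a (target d) →
    (p : ℕ) → Prime p → (+ p) * a p ≡ (d + + 1) ^ p - d ^ p - + 1
mainTheorem3 d a expansion p p-prime = isolate (+ p * a p) (d ^ p) ((d + 1ℤ) ^ p) (begin
  - 1ℤ - + p * a p + - (d ^ p)
    ≡⟨ cong (λ t → - t - + p * a p + - (d ^ p)) (sym (trans (cong (_^ p) a₁≡1) (ℤP.^-zeroˡ p))) ⟩
  - (a 1 ^ p) - + p * a p + - (d ^ p)
    ≡⟨ cong₂ _+_ (sym (logProd-at-prime a p p-prime)) (sym (logFactor-linear d p)) ⟩
  logProd a p p + logFactor d 0 p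
    ≡⟨ logDeriv-unique W U (logProd a p ⊕ logFactor d 0) (zeroS ⊕ logFactor (d + 1ℤ) 0) p
         (W≗U 0 z≤n) W≗U θW θU p ℕP.≤-refl ⟩
  0ℤ + logFactor (d + 1ℤ) 0 p
    ≡⟨ trans (ℤP.+-identityˡ _) (logFactor-linear (d + 1ℤ) p) ⟩
  - ((d + 1ℤ) ^ p) ∎)
  where
  instance
    p≢0 : NonZero p
    p≢0 = prime⇒nonZero p-prime
  a₁≡1 : a 1 ≡ 1ℤ
  a₁≡1 = expansion-first d a expansion
  W U : Series
  W = prodUpTo a p ⊛ factor (λ _ → d) 1
  U = oneS ⊛ factor (λ _ → d + 1ℤ) 1
  W≗U : ∀ k → k ≤ p → W k ≡ U k
  W≗U = expansion-times-factor d a p expansion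
  θW : LogDeriv W (logProd a p ⊕ logFactor d 0)
  θW = logDeriv-mulFactor (prodUpTo a p) (logProd a p) (λ _ → d) 0 (logDeriv-prodUpTo a p)
  θU : LogDeriv U (zeroS ⊕ logFactor (d + 1ℤ) 0)
  θU = logDeriv-mulFactor oneS zeroS (λ _ → d + 1ℤ) 0 logDeriv-oneS
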